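{- For every integer $d\ge 1$ there exists $n_0(d)$ such that for all $n\ge n_0(d)$, \[ \mathrm{HG}(B_{d,n}) = h(\mathbb{N}^d)+1. \]
   Context: Hat guessing game: players sit on the vertices of a finite simple graph $G$; an adversary places on each vertex a hat of one of $q$ colors. Each player sees only the hat colors of its neighbors (not its own) and, following a strategy agreed in advance (a deterministic function of the colors it sees), guesses its own hat color; all guess simultaneously. The players win if at least one player guesses correctly. The hat guessing number $\mathrm{HG}(G)$ is the largest $q$ for which the players have a strategy that wins for every hat assignment with $q$ colors. The book graph $B_{d,n}$ is obtained from $K_{n+d}$ by removing the edges of an $n$-clique: a $d$-clique (spine) all of whose vertices are adjacent to each of $n$ pairwise non-adjacent vertices (pages). A set $S\subseteq\mathbb{N}^d$ is coverable if there is a partition $S=S_1\sqcup\cdots\sqcup S_d$ such that, for each $i$, $S_i$ contains at most one point on any line parallel to the $i$-th coordinate axis. $h(\mathbb{N}^d)$ denotes the largest $t$ such that every $t$-element subset of $\mathbb{N}^d$ is coverable. -}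

module Defs where

open import Data.Nat using (ℕ; _+_; _<_; _≤_)
open import Data.Fin using (Fin; toℕ)
open import Data.Vec using (Vec; lookup)
open import Data.Product using (Σ; ∃; _×_)
open import Data.Sum using (_⊎_)
open import Relation.Binary.PropositionalEquality using (_≡_; _≢_)
open import Function.Definitions using (Injective)

record Strategy (V : ℕ) (Adj : Fin V → Fin V → Set) (q : ℕ) : Set where
  field
    guess : Fin V → (Fin V → Fin q) → Fin q
    local : ∀ v (c c′ : Fin V → Fin q) →
            (∀ u → Adj v u → c u ≡ c′ u) → guess v c ≡ guess v c′

Wins : (V : ℕ) (Adj : Fin V → Fin V → Set) (q : ℕ) → Set
Wins V Adj q = Σ (Strategy V Adj q) λ s →
  ∀ (c : Fin V → Fin q) → ∃ λ v → Strategy.guess s v c ≡ c v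

-- Book graph B_{d,n}: vertices Fin (d + n); those with index < d form the spine.
-- Two distinct vertices are adjacent iff at least one lies in the spine.
BookAdj : (d n : ℕ) → Fin (d + n) → Fin (d + n) → Set
BookAdj d n u v = u ≢ v × (toℕ u < d ⊎ toℕ v < d)

IsLargest : (ℕ → Set) → ℕ → Set
IsLargest P m = P m × (∀ k → P k → k ≤ m)

HGBookIs : (d n m : ℕ) → Set
HGBookIs d n m = IsLargest (Wins (d + n) (BookAdj d n)) m

-- A t-element subset of ℕ^d given by an injective enumeration p : Fin t → ℕ^d is
-- coverable if there is a partition σ : Fin t → Fin d (point a goes to S_{σ a}) such
-- that S_i has at most one point on each line parallel to the i-th axis.
Coverable : (d t : ℕ) → (Fin t → Vec ℕ d) → Set
Coverable d t p = Σ (Fin t → Fin d) λ σ →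
  ∀ (i : Fin d) (a b : Fin t) → σ a ≡ i → σ b ≡ i →
  (∀ (j : Fin d) → j ≢ i → lookup (p a) j ≡ lookup (p b) j) → a ≡ b

AllCoverable : (d t : ℕ) → Set
AllCoverable d t = ∀ (p : Fin t → Vec ℕ d) → Injective _≡_ _≡_ p → Coverable d t p

HIs : (d t : ℕ) → Set
HIs d t = IsLargest (AllCoverable d) t

-- h(ℕ^d) exists: coverability of a point set depends only on its pattern of coordinate
-- coincidences, so it suffices to decide it for points in (Fin t)^d; it is inherited by smaller
-- sets, and the grid [d+1]^d is not coverable, since it has more points than there are lines.
--
-- HG(B_{d,n}) ≤ h + 1: given a winning strategy with k > m colours and m points, colour the
-- spine by a point and each page by a colour that its guess, which depends on the spine only,
-- never takes on these m spine colourings. Then some spine player wins, and sending each point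
-- to the axis of its winning player is a covering.
--
-- HG(B_{d,n}) ≥ h + 1 for q = h + 1 colours: for each map g from colours to spine colourings
-- there is a page guessing some colour that g sends to the spine colouring it sees. The spine
-- colourings on which every page fails form a set of at most h points (q of them, listed by an
-- injective g, would make the page of g right), so they have a covering, and the spine player
-- on the axis assigned to the actual spine colouring recovers its own colour from the others.

module Submission where

open import Defs
open import Data.Nat using (ℕ; zero; suc; _≤_; _<_; _+_; _*_; _^_)
import Data.Nat.Properties as ℕ
open import Data.Fin
  using (Fin; zero; suc; toℕ; join; fromℕ<; inject≤; _↑ˡ_; _↑ʳ_; splitAt; punchIn; punchOut;
         funToFin; finToFun; combine)
open import Data.Fin.Properties
  using (any?; all?; _≟_; pigeonhole; <⇒≢; toℕ-injective; toℕ<n; toℕ-↑ˡ; toℕ-↑ʳ; ↑ˡ-injective;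
         inject≤-injective; splitAt-↑ˡ; splitAt-↑ʳ; join-splitAt; finToFun-funToFin;
         funToFin-finToFin; combine-injective; punchIn-punchOut)
open import Data.Vec using (Vec; lookup; tabulate; map; replicate; _∷_)
open import Data.Vec.Properties using (lookup∘tabulate; tabulate-cong; tabulate∘lookup; lookup-map)
import Data.Vec.Properties as Vec
open import Data.Vec.Relation.Binary.Pointwise.Extensional using (ext; Pointwise-≡⇒≡)
open import Data.Product using (Σ; ∃; _×_; _,_; proj₁; proj₂)
open import Data.Sum using (_⊎_; inj₁; inj₂; [_,_]′)
open import Relation.Nullary using (Dec; yes; no; ¬_; contradiction)
open import Relation.Nullary.Decidable using (map′; decidable-stable; ¬?; _×-dec_; _⊎-dec_; _→-dec_)
open import Relation.Binary using (DecidableEquality)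
open import Relation.Binary.PropositionalEquality
open import Function using (_∘_)
open import Data.List as List using (List; length; filter; allFin; _∷_)
open import Data.List.Membership.Propositional.Properties
  using (∈-lookup; ∈-filter⁺; ∈-filter⁻; ∈-allFin)
import Data.List.Relation.Unary.All as All
open import Data.List.Relation.Unary.AllPairs using (_∷_)
import Data.List.Relation.Unary.Any as Any
open import Data.List.Relation.Unary.Any.Properties using (lookup-index)
open import Data.List.Relation.Unary.Unique.Propositional using (Unique)
open import Data.List.Relation.Unary.Unique.Propositional.Properties using (filter⁺; allFin⁺)
open import Function.Definitions using (Injective)

variable
  A B : Set
  d t m k : ℕ

vec-ext : {u v : Vec A d} → (∀ j → lookup u j ≡ lookup v j) → u ≡ v
vec-ext h = Pointwise-≡⇒≡ (ext h)

funToFin-cong : {f g : Fin d → Fin k} → (∀ j → f j ≡ g j) → funToFin f ≡ funToFin g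
funToFin-cong {zero} f≗g = refl
funToFin-cong {suc d} f≗g = cong₂ combine (f≗g zero) (funToFin-cong (f≗g ∘ suc))

decodeVec : Fin (k ^ d) → Vec (Fin k) d
decodeVec z = tabulate (finToFun z)

encodeVec : Vec (Fin k) d → Fin (k ^ d)
encodeVec v = funToFin (lookup v)

decodeVec-encodeVec : (v : Vec (Fin k) d) → decodeVec (encodeVec v) ≡ v
decodeVec-encodeVec v = trans (tabulate-cong (finToFun-funToFin (lookup v))) (tabulate∘lookup v)

decodeVec-injective : Injective _≡_ _≡_ (decodeVec {k} {d})
decodeVec-injective {k} {d} {y} {z} e = begin
  y                                 ≡⟨ funToFin-finToFin {d} {k} y ⟨
  funToFin (finToFun {k} {d} y)     ≡⟨ funToFin-cong coordinates-agree ⟩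
  funToFin (finToFun {k} {d} z)     ≡⟨ funToFin-finToFin {d} {k} z ⟩
  z                                 ∎
  where
  open ≡-Reasoning
  coordinates-agree : ∀ j → finToFun {k} {d} y j ≡ finToFun z j
  coordinates-agree j = trans (sym (lookup∘tabulate _ j))
                          (trans (cong (λ u → lookup u j) e) (lookup∘tabulate _ j))

funToFin-injective : {f g : Fin d → Fin k} → funToFin f ≡ funToFin g → ∀ j → f j ≡ g j
funToFin-injective {f = f} {g} e j =
  trans (sym (finToFun-funToFin f j)) (trans (cong (λ z → finToFun z j) e) (finToFun-funToFin g j))

[,]-injective : {C : Set} {f : A → C} {g : B → C} → Injective _≡_ _≡_ f → Injective _≡_ _≡_ g →
                (∀ x y → f x ≢ g y) → Injective _≡_ _≡_ [ f , g ]′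
[,]-injective f-inj g-inj f≢g {inj₁ x} {inj₁ y} e = cong inj₁ (f-inj e)
[,]-injective f-inj g-inj f≢g {inj₁ x} {inj₂ y} e = contradiction e (f≢g x y)
[,]-injective f-inj g-inj f≢g {inj₂ x} {inj₁ y} e = contradiction (sym e) (f≢g y x)
[,]-injective f-inj g-inj f≢g {inj₂ x} {inj₂ y} e = cong inj₂ (g-inj e)

splitAt-injective : ∀ m {n} → Injective _≡_ _≡_ (splitAt m {n})
splitAt-injective m {n} {a} {b} e =
  trans (sym (join-splitAt m n a)) (trans (cong (join m n) e) (join-splitAt m n b))

lookup-injective : {xs : List A} → Unique xs → Injective _≡_ _≡_ (List.lookup xs)
lookup-injective {xs = _ ∷ _} (_ ∷ _) {zero} {zero} _ = refl
lookup-injective {xs = _ ∷ _} (x∉xs ∷ _) {zero} {suc j} e =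
  contradiction e (All.lookup x∉xs (∈-lookup j))
lookup-injective {xs = _ ∷ _} (x∉xs ∷ _) {suc i} {zero} e =
  contradiction (sym e) (All.lookup x∉xs (∈-lookup i))
lookup-injective {xs = _ ∷ _} (_ ∷ xs-unique) {suc i} {suc j} e =
  cong suc (lookup-injective xs-unique e)

module _ (_≈?_ : DecidableEquality B) (f : Fin t → B) where

  preimage : Fin t → B → Fin t
  preimage a₀ v with any? (λ a → f a ≈? v)
  ... | yes (a , _) = a
  ... | no _ = a₀

  preimage-correct : ∀ {a a₀ v} → f a ≡ v → f (preimage a₀ v) ≡ v
  preimage-correct {a} {a₀} {v} fa≡v with any? (λ a → f a ≈? v)
  ... | yes (_ , fa′≡v) = fa′≡v
  ... | no ∄a = contradiction (a , fa≡v) ∄a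

  preimage-default : ∀ {a a₀ a₁ v} → f a ≡ v → preimage a₀ v ≡ preimage a₁ v
  preimage-default {a} {a₀} {a₁} {v} fa≡v with any? (λ a → f a ≈? v)
  ... | yes _ = refl
  ... | no ∄a = contradiction (a , fa≡v) ∄a

  preimage-injective : Injective _≡_ _≡_ f → ∀ {a₀} a → preimage a₀ (f a) ≡ a
  preimage-injective f-inj a = f-inj (preimage-correct refl)

not-surjective : m < k → (f : Fin m → Fin k) → ¬ (∀ c → ∃ λ a → f a ≡ c)
not-surjective m<k f section with i , j , i<j , same ← pigeonhole m<k (proj₁ ∘ section)
  = <⇒≢ i<j (trans (sym (proj₂ (section i))) (trans (cong f same) (proj₂ (section j))))

missed-value : m < k → (f : Fin m → Fin k) → ∃ λ c → ∀ a → f a ≢ c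
missed-value m<k f with any? (λ c → ¬? (any? λ a → f a ≟ c))
... | yes (c , ∄a) = c , λ a fa≡c → ∄a (a , fa≡c)
... | no ∄c = contradiction (λ c → decidable-stable (any? λ a → f a ≟ c) λ ∄a → ∄c (c , ∄a))
                            (not-surjective m<k f)

largest : {P : ℕ → Set} → (∀ k → Dec (P k)) → P 0 →
          ∀ N → (∀ k → P k → k ≤ N) → ∃ (IsLargest P)
largest P? P0 zero bounded = 0 , P0 , bounded
largest P? P0 (suc N) bounded with P? (suc N)
... | yes PN = suc N , PN , bounded
... | no ¬PN = largest P? P0 N λ k Pk → ℕ.≤-pred (ℕ.≤∧≢⇒< (bounded k Pk) λ { refl → ¬PN Pk })

-- Coverings

AgreeOff : Fin d → Vec A d → Vec A d → Set
AgreeOff i u v = ∀ j → j ≢ i → lookup u j ≡ lookup v j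

CoveredBy : (Fin t → Vec A d) → (Fin t → Fin d) → Set
CoveredBy p σ = ∀ i a b → σ a ≡ i → σ b ≡ i → AgreeOff i (p a) (p b) → a ≡ b

-- AllCoverable d t is, by definition, AllCoverableOver ℕ d t.
AllCoverableOver : Set → ℕ → ℕ → Set
AllCoverableOver A d t =
  ∀ (p : Fin t → Vec A d) → Injective _≡_ _≡_ p → Σ (Fin t → Fin d) (CoveredBy p)

agreeOff-≡ : ∀ {i} {u v : Vec A d} → AgreeOff i u v → lookup u i ≡ lookup v i → u ≡ v
agreeOff-≡ {i = i} {u} {v} agree same = vec-ext coordinate
  where
  coordinate : ∀ j → lookup u j ≡ lookup v j
  coordinate j with j ≟ i
  ... | yes refl = same
  ... | no j≢i = agree j j≢i

record Finer (p : Fin t → Vec A d) (p′ : Fin t → Vec B d) : Set where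
  constructor finer
  field
    coincidence : ∀ a b j → lookup (p a) j ≡ lookup (p b) j → lookup (p′ a) j ≡ lookup (p′ b) j
open Finer

pointwise⇒finer : {p p′ : Fin t → Vec A d} → (∀ a → p a ≡ p′ a) → Finer p p′
pointwise⇒finer p≗p′ = finer λ a b j e → trans (cong (λ u → lookup u j) (sym (p≗p′ a)))
                                                  (trans e (cong (λ u → lookup u j) (p≗p′ b)))

finer-injective : {p : Fin t → Vec A d} {p′ : Fin t → Vec B d} →
                  Finer p p′ → Injective _≡_ _≡_ p′ → Injective _≡_ _≡_ p
finer-injective p⊑p′ inj {a} {b} e =
  inj (vec-ext λ j → coincidence p⊑p′ a b j (cong (λ u → lookup u j) e))

finer-coveredBy : {p : Fin t → Vec A d} {p′ : Fin t → Vec B d} {σ : Fin t → Fin d} →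
                  Finer p p′ → CoveredBy p′ σ → CoveredBy p σ
finer-coveredBy p⊑p′ cov i a b σa σb agree =
  cov i a b σa σb λ j j≢i → coincidence p⊑p′ a b j (agree j j≢i)

coveredBy-resp : {p : Fin t → Vec A d} {σ σ′ : Fin t → Fin d} →
                 (∀ a → σ a ≡ σ′ a) → CoveredBy p σ → CoveredBy p σ′
coveredBy-resp σ≗σ′ cov i a b σ′a σ′b = cov i a b (trans (σ≗σ′ a) σ′a) (trans (σ≗σ′ b) σ′b)

finer-trans : {p : Fin t → Vec A d} {p′ : Fin t → Vec B d} {C : Set} {p″ : Fin t → Vec C d} →
              Finer p p′ → Finer p′ p″ → Finer p p″
finer-trans p⊑p′ p′⊑p″ = finer λ a b j → coincidence p′⊑p″ a b j ∘ coincidence p⊑p′ a b j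

coveredBy-restrict : {p : Fin k → Vec A d} {σ : Fin k → Fin d} (f : Fin t → Fin k) →
                     Injective _≡_ _≡_ f → CoveredBy p σ → CoveredBy (p ∘ f) (σ ∘ f)
coveredBy-restrict f f-inj cov i a b σa σb agree = f-inj (cov i (f a) (f b) σa σb agree)

allCoverableOver-transfer : (∀ (p : Fin t → Vec A d) → Injective _≡_ _≡_ p →
                              Σ (Fin t → Vec B d) λ p′ → Finer p p′ × Finer p′ p) →
                            AllCoverableOver B d t → AllCoverableOver A d t
allCoverableOver-transfer similar cover p inj with similar p inj
... | p′ , p⊑p′ , p′⊑p with cover p′ (finer-injective p′⊑p inj)
...   | σ , cov = σ , finer-coveredBy p⊑p′ cov

map-finer : {f : A → B} (p : Fin t → Vec A d) → Finer p (map f ∘ p)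
map-finer {f = f} p = finer λ a b j e →
  trans (lookup-map j f (p a)) (trans (cong f e) (sym (lookup-map j f (p b))))

map-finer⁻ : {f : A → B} → Injective _≡_ _≡_ f → (p : Fin t → Vec A d) → Finer (map f ∘ p) p
map-finer⁻ {f = f} f-inj p = finer λ a b j e →
  f-inj (trans (sym (lookup-map j f (p a))) (trans e (lookup-map j f (p b))))

allCoverableOver-embed : (f : A → B) → Injective _≡_ _≡_ f →
                         AllCoverableOver B d t → AllCoverableOver A d t
allCoverableOver-embed f f-inj =
  allCoverableOver-transfer λ p _ → map f ∘ p , map-finer p , map-finer⁻ f-inj p

compress : DecidableEquality A → (Fin t → Vec A d) → Fin t → Vec (Fin t) d
compress _≈?_ p a = tabulate λ j → preimage _≈?_ (λ b → lookup (p b) j) a (lookup (p a) j)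

module _ (_≈?_ : DecidableEquality A) (p : Fin t → Vec A d) where

  private
    column : Fin d → Fin t → A
    column j b = lookup (p b) j

    lookup-compress : ∀ a j → lookup (compress _≈?_ p a) j ≡ preimage _≈?_ (column j) a (column j a)
    lookup-compress a j = lookup∘tabulate _ j

  compress-finer : Finer p (compress _≈?_ p)
  compress-finer = finer λ a b j e → begin
    lookup (compress _≈?_ p a) j                  ≡⟨ lookup-compress a j ⟩
    preimage _≈?_ (column j) a (column j a)       ≡⟨ cong (preimage _≈?_ (column j) a) e ⟩
    preimage _≈?_ (column j) a (column j b)       ≡⟨ preimage-default _≈?_ (column j) refl ⟩
    preimage _≈?_ (column j) b (column j b)       ≡⟨ lookup-compress b j ⟨
    lookup (compress _≈?_ p b) j                  ∎
    where open ≡-Reasoning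

  compress-finer⁻ : Finer (compress _≈?_ p) p
  compress-finer⁻ = finer same-column
    where
    same-column : ∀ a b j → lookup (compress _≈?_ p a) j ≡ lookup (compress _≈?_ p b) j →
                  column j a ≡ column j b
    same-column a b j e = begin
      column j a                                          ≡⟨ preimage-correct _≈?_ (column j) refl ⟨
      column j (preimage _≈?_ (column j) a (column j a))  ≡⟨ cong (column j) same-representative ⟩
      column j (preimage _≈?_ (column j) b (column j b))  ≡⟨ preimage-correct _≈?_ (column j) refl ⟩
      column j b                                          ∎
      where
      open ≡-Reasoning
      same-representative = trans (sym (lookup-compress a j)) (trans e (lookup-compress b j))

allCoverableOver-compress : DecidableEquality A →
                            AllCoverableOver (Fin t) d t → AllCoverableOver A d t
allCoverableOver-compress _≈?_ =
  allCoverableOver-transfer λ p _ → compress _≈?_ p , compress-finer _≈?_ p , compress-finer⁻ _≈?_ p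

injective? : DecidableEquality B → (f : Fin t → B) → Dec (Injective _≡_ _≡_ f)
injective? _≈?_ f = map′ (λ inj {a} {b} → inj a b) (λ inj a b → inj)
  (all? λ a → all? λ b → (f a ≈? f b) →-dec (a ≟ b))

agreeOff? : DecidableEquality A → ∀ (i : Fin d) u v → Dec (AgreeOff i u v)
agreeOff? _≈?_ i u v = all? λ j → ¬? (j ≟ i) →-dec (lookup u j ≈? lookup v j)

coveredBy? : DecidableEquality A → (p : Fin t → Vec A d) (σ : Fin t → Fin d) →
             Dec (CoveredBy p σ)
coveredBy? _≈?_ p σ = all? λ i → all? λ a → all? λ b →
  (σ a ≟ i) →-dec ((σ b ≟ i) →-dec (agreeOff? _≈?_ i (p a) (p b) →-dec (a ≟ b)))

allCoverableOverFin? : ∀ d t → Dec (AllCoverableOver (Fin t) d t)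
allCoverableOverFin? d t = map′ fromCodes toCodes
  (all? λ e → injective? (Vec.≡-dec _≟_) (points e) →-dec
              any? λ s → coveredBy? _≟_ (points e) (finToFun s))
  where
  points : Fin ((t ^ d) ^ t) → Fin t → Vec (Fin t) d
  points e a = decodeVec (finToFun e a)

  points-encode : (p : Fin t → Vec (Fin t) d) → ∀ a → points (funToFin (encodeVec ∘ p)) a ≡ p a
  points-encode p a =
    trans (cong decodeVec (finToFun-funToFin (encodeVec ∘ p) a)) (decodeVec-encodeVec (p a))

  fromCodes : (∀ e → Injective _≡_ _≡_ (points e) → ∃ λ s → CoveredBy (points e) (finToFun s)) →
              AllCoverableOver (Fin t) d t
  fromCodes decided p inj =
    let code = funToFin (encodeVec ∘ p)
        s , cov = decided code (finer-injective (pointwise⇒finer (points-encode p)) inj)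
    in finToFun s , finer-coveredBy (pointwise⇒finer (sym ∘ points-encode p)) cov

  toCodes : AllCoverableOver (Fin t) d t →
            ∀ e → Injective _≡_ _≡_ (points e) → ∃ λ s → CoveredBy (points e) (finToFun s)
  toCodes cover e inj =
    let σ , cov = cover (points e) inj
    in funToFin σ , coveredBy-resp {p = points e} (sym ∘ finToFun-funToFin σ) cov

allCoverable? : ∀ d t → Dec (AllCoverable d t)
allCoverable? d t = map′ (allCoverableOver-compress ℕ._≟_)
                         (allCoverableOver-embed toℕ toℕ-injective)
                         (allCoverableOverFin? d t)

-- Padding with r points far from the m given ones (after shifting those by r).
allCoverable[m+r]⇒allCoverable[m] : ∀ r → AllCoverable (suc d) (m + r) → AllCoverable (suc d) m
allCoverable[m+r]⇒allCoverable[m] {d} {m} r cover g g-inj =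
  σ ∘ (_↑ˡ r) ,
  finer-coveredBy g⊑padded (coveredBy-restrict {p = padded} (_↑ˡ r) (↑ˡ-injective r _ _) cov)
  where
  shifted : Fin m → Vec ℕ (suc d)
  shifted = map (r +_) ∘ g

  far : Fin r → Vec ℕ (suc d)
  far s = toℕ s ∷ replicate d 0

  padded : Fin (m + r) → Vec ℕ (suc d)
  padded = [ shifted , far ]′ ∘ splitAt m

  shifted≢far : ∀ x s → shifted x ≢ far s
  shifted≢far x s e = ℕ.<⇒≱ (toℕ<n s)
    (subst (r ≤_) (trans (sym (lookup-map zero (r +_) (g x))) (cong (λ u → lookup u zero) e))
           (ℕ.m≤m+n r _))

  far-injective : Injective _≡_ _≡_ far
  far-injective e = toℕ-injective (cong (λ u → lookup u zero) e)

  padded-injective : Injective _≡_ _≡_ padded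
  padded-injective = splitAt-injective m
                   ∘ [,]-injective (finer-injective (map-finer⁻ (ℕ.+-cancelˡ-≡ r _ _) g) g-inj)
                                   far-injective shifted≢far

  σ = proj₁ (cover padded padded-injective)
  cov = proj₂ (cover padded padded-injective)

  g⊑padded : Finer g (padded ∘ (_↑ˡ r))
  g⊑padded = finer-trans (map-finer g)
               (pointwise⇒finer λ x → sym (cong [ shifted , far ]′ (splitAt-↑ˡ m x r)))

allCoverable-antitone : m ≤ k → AllCoverable (suc d) k → AllCoverable (suc d) m
allCoverable-antitone m≤k with ℕ.m≤n⇒∃[o]m+o≡n m≤k
... | r , refl = allCoverable[m+r]⇒allCoverable[m] r

module _ {D : ℕ} (σ : Fin (D ^ suc d) → Fin (suc d)) where

  private
    coords : Fin (D ^ suc d) → Fin (suc d) → Fin D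
    coords = finToFun

  -- The line through z parallel to the σ z-th axis, tagged with σ z.
  taggedLine : Fin (D ^ suc d) → Fin (suc d * D ^ d)
  taggedLine z = combine (σ z) (funToFin (coords z ∘ punchIn (σ z)))

  taggedLine-agreeOff : ∀ a b → taggedLine a ≡ taggedLine b →
                        σ a ≡ σ b × AgreeOff (σ a) (decodeVec {D} a) (decodeVec b)
  taggedLine-agreeOff a b e = σa≡σb , agree
    where
    σa≡σb = proj₁ (combine-injective (σ a) _ (σ b) _ e)
    off-line = funToFin-injective (proj₂ (combine-injective (σ a) _ (σ b) _ e))

    agree : AgreeOff (σ a) (decodeVec {D} a) (decodeVec b)
    agree j j≢σa = begin
      lookup (decodeVec {D} a) j                    ≡⟨ lookup∘tabulate (coords a) j ⟩
      coords a j                                    ≡⟨ cong (coords a) (punchIn-punchOut σa≢j) ⟨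
      coords a (punchIn (σ a) j′)                   ≡⟨ off-line j′ ⟩
      coords b (punchIn (σ b) j′)                   ≡⟨ cong (λ i → coords b (punchIn i j′)) σa≡σb ⟨
      coords b (punchIn (σ a) j′)                   ≡⟨ cong (coords b) (punchIn-punchOut σa≢j) ⟩
      coords b j                                    ≡⟨ lookup∘tabulate (coords b) j ⟨
      lookup (decodeVec {D} b) j                    ∎
      where
      open ≡-Reasoning
      σa≢j = j≢σa ∘ sym
      j′ = punchOut σa≢j

-- The grid has D · D ^ d points but there are only (d + 1) · D ^ d tagged lines.
grid-not-coveredBy : ∀ {D} → suc d < D → (σ : Fin (D ^ suc d) → Fin (suc d)) →
                     ¬ CoveredBy (decodeVec {D}) σ
grid-not-coveredBy {d} {D@(suc _)} d<D σ cov
  with a , b , a<b , same ← pigeonhole (ℕ.*-monoˡ-< (D ^ d) {{ℕ.m^n≢0 D d}} d<D) (taggedLine σ)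
  = let σa≡σb , agree = taggedLine-agreeOff σ a b same
    in <⇒≢ a<b (cov (σ a) a b refl (sym σa≡σb) agree)

allCoverable-bounded : AllCoverable (suc d) k → k < suc (suc d) ^ suc d
allCoverable-bounded {d} {k} cover = ℕ.≰⇒> λ N≤k →
  let σ , cov = allCoverableOver-embed toℕ toℕ-injective (allCoverable-antitone N≤k cover)
                  decodeVec decodeVec-injective
  in grid-not-coveredBy ℕ.≤-refl σ cov

allCoverable-zero : AllCoverable d 0
allCoverable-zero p _ = (λ ()) , λ _ ()

h-exists : ∀ d → ∃ (HIs (suc d))
h-exists d = largest (allCoverable? (suc d)) allCoverable-zero _ λ _ → ℕ.<⇒≤ ∘ allCoverable-bounded

module _ (_≈?_ : DecidableEquality A) (p : Fin t → Vec A d) (σ : Fin t → Fin d) where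

  recover : A → Fin d → Vec A d → A
  recover a₀ i y with any? (λ a → (σ a ≟ i) ×-dec agreeOff? _≈?_ i (p a) y)
  ... | yes (a , _) = lookup (p a) i
  ... | no _ = a₀

  recover-correct : CoveredBy p σ → ∀ {a₀ i y} a → σ a ≡ i → AgreeOff i (p a) y →
                    recover a₀ i y ≡ lookup (p a) i
  recover-correct cov {a₀} {i} {y} a σa agree
    with any? (λ a → (σ a ≟ i) ×-dec agreeOff? _≈?_ i (p a) y)
  ... | yes (b , σb , agree-b) = cong (λ c → lookup (p c) i)
          (cov i b a σb σa λ j j≢i → trans (agree-b j j≢i) (sym (agree j j≢i)))
  ... | no ∄b = contradiction (a , σa , agree) ∄b

-- Hat guessing on book graphs

-- Strategies that read the colouring through what a player sees (non-neighbours blanked) are local.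
module _ {V q : ℕ} {Adj : Fin V → Fin V → Set} (adj? : ∀ u v → Dec (Adj u v)) (blank : Fin q)
  where

  private
    shown : Fin V → (Fin V → Fin q) → Fin V → Fin q
    shown v c u with adj? v u
    ... | yes _ = c u
    ... | no _ = blank

  view : Fin V → (Fin V → Fin q) → Vec (Fin q) V
  view v c = tabulate (shown v c)

  lookup-view : ∀ {v u} (c : Fin V → Fin q) → Adj v u → lookup (view v c) u ≡ c u
  lookup-view {v} {u} c adj = trans (lookup∘tabulate (shown v c) u) shown-adjacent
    where
    shown-adjacent : shown v c u ≡ c u
    shown-adjacent with adj? v u
    ... | yes _ = refl
    ... | no ¬adj = contradiction adj ¬adj

  view-local : ∀ v (c c′ : Fin V → Fin q) → (∀ u → Adj v u → c u ≡ c′ u) → view v c ≡ view v c′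
  view-local v c c′ agree = tabulate-cong shown-local
    where
    shown-local : ∀ u → shown v c u ≡ shown v c′ u
    shown-local u with adj? v u
    ... | yes adj = agree u adj
    ... | no _ = refl

  viewStrategy : (Fin V → Vec (Fin q) V → Fin q) → Strategy V Adj q
  viewStrategy g = record
    { guess = λ v c → g v (view v c)
    ; local = λ v c c′ agree → cong (g v) (view-local v c c′ agree)
    }

module Book (d n : ℕ) where

  spine : Fin d → Fin (d + n)
  spine j = j ↑ˡ n

  page : Fin n → Fin (d + n)
  page r = d ↑ʳ r

  data Vertex : Fin (d + n) → Set where
    spineVertex : ∀ j → Vertex (spine j)
    pageVertex : ∀ r → Vertex (page r)

  vertex : ∀ u → Vertex u
  vertex u = subst Vertex (join-splitAt d n u) (fromSplit (splitAt d u))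
    where
    fromSplit : (s : Fin d ⊎ Fin n) → Vertex (join d n s)
    fromSplit (inj₁ j) = spineVertex j
    fromSplit (inj₂ r) = pageVertex r

  onVertices : {X : Set} → (Fin d → X) → (Fin n → X) → Fin (d + n) → X
  onVertices x c = [ x , c ]′ ∘ splitAt d

  onVertices-spine : {X : Set} (x : Fin d → X) (c : Fin n → X) →
                     ∀ j → onVertices x c (spine j) ≡ x j
  onVertices-spine x c j = cong [ x , c ]′ (splitAt-↑ˡ d j n)

  onVertices-page : {X : Set} (x : Fin d → X) (c : Fin n → X) →
                    ∀ r → onVertices x c (page r) ≡ c r
  onVertices-page x c r = cong [ x , c ]′ (splitAt-↑ʳ d n r)

  toℕ-spine : ∀ j → toℕ (spine j) < d
  toℕ-spine j = subst (_< d) (sym (toℕ-↑ˡ j n)) (toℕ<n j)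

  toℕ-page : ∀ r → d ≤ toℕ (page r)
  toℕ-page r = subst (d ≤_) (sym (toℕ-↑ʳ d r)) (ℕ.m≤m+n d (toℕ r))

  spine≢page : ∀ j r → spine j ≢ page r
  spine≢page j r e = ℕ.<⇒≱ (toℕ-spine j) (subst (λ u → d ≤ toℕ u) (sym e) (toℕ-page r))

  spine-adjacent : ∀ i u → u ≢ spine i → BookAdj d n (spine i) u
  spine-adjacent i u u≢i = u≢i ∘ sym , inj₁ (toℕ-spine i)

  page-adjacent : ∀ r j → BookAdj d n (page r) (spine j)
  page-adjacent r j = spine≢page j r ∘ sym , inj₂ (toℕ-spine j)

  pages-nonadjacent : ∀ r s → ¬ BookAdj d n (page r) (page s)
  pages-nonadjacent r s (_ , inj₁ r<d) = ℕ.<⇒≱ r<d (toℕ-page r)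
  pages-nonadjacent r s (_ , inj₂ s<d) = ℕ.<⇒≱ s<d (toℕ-page s)

  bookAdj? : ∀ u v → Dec (BookAdj d n u v)
  bookAdj? u v = ¬? (u ≟ v) ×-dec (toℕ u ℕ.<? d ⊎-dec toℕ v ℕ.<? d)

module UpperBound {d n k : ℕ} (W : Wins (d + n) (BookAdj d n) k) where
  open Book d n
  open Strategy (proj₁ W)

  pages-see-only-spine : ∀ r (x : Fin d → Fin k) (c c′ : Fin n → Fin k) →
                         guess (page r) (onVertices x c) ≡ guess (page r) (onVertices x c′)
  pages-see-only-spine r x c c′ = local (page r) _ _ agree
    where
    agree : ∀ u → BookAdj d n (page r) u → onVertices x c u ≡ onVertices x c′ u
    agree u adj with vertex u
    ... | spineVertex j = trans (onVertices-spine x c j) (sym (onVertices-spine x c′ j))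
    ... | pageVertex s = contradiction adj (pages-nonadjacent r s)

  wins⇒allCoverableOver : m < k → AllCoverableOver (Fin k) d m
  wins⇒allCoverableOver {m} m<k p p-inj = σ , covering
    where
    blankPage : Fin n → Fin k
    blankPage _ = fromℕ< m<k

    avoided : Fin n → Fin k
    avoided r = proj₁ (missed-value m<k λ a → guess (page r) (onVertices (lookup (p a)) blankPage))

    colouring : Fin m → Fin (d + n) → Fin k
    colouring a = onVertices (lookup (p a)) avoided

    page-wrong : ∀ a r → guess (page r) (colouring a) ≢ colouring a (page r)
    page-wrong a r right =
      proj₂ (missed-value m<k _) a
        (trans (pages-see-only-spine r (lookup (p a)) blankPage avoided)
               (trans right (onVertices-page (lookup (p a)) avoided r)))

    spine-right : ∀ a → ∃ λ i → guess (spine i) (colouring a) ≡ lookup (p a) i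
    spine-right a with proj₂ W (colouring a)
    ... | u , right with vertex u
    ...   | spineVertex i = i , trans right (onVertices-spine (lookup (p a)) avoided i)
    ...   | pageVertex r = contradiction right (page-wrong a r)

    σ : Fin m → Fin d
    σ a = proj₁ (spine-right a)

    covering : CoveredBy p σ
    covering i a b refl σb≡σa agree = p-inj (agreeOff-≡ agree (begin
      lookup (p a) (σ a)                 ≡⟨ proj₂ (spine-right a) ⟨
      guess (spine (σ a)) (colouring a)  ≡⟨ local (spine (σ a)) _ _ same-view ⟩
      guess (spine (σ a)) (colouring b)  ≡⟨ cong (λ i → guess (spine i) (colouring b)) σb≡σa ⟨
      guess (spine (σ b)) (colouring b)  ≡⟨ proj₂ (spine-right b) ⟩
      lookup (p b) (σ b)                 ≡⟨ cong (lookup (p b)) σb≡σa ⟩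
      lookup (p b) (σ a)                 ∎))
      where
      open ≡-Reasoning
      same-view : ∀ u → BookAdj d n (spine (σ a)) u → colouring a u ≡ colouring b u
      same-view u (u≢ , _) with vertex u
      ... | spineVertex j = trans (onVertices-spine _ avoided j)
                              (trans (agree j (u≢ ∘ cong spine ∘ sym))
                                     (sym (onVertices-spine _ avoided j)))
      ... | pageVertex r = trans (onVertices-page _ avoided r) (sym (onVertices-page _ avoided r))

allCoverableOver-Fin⇒allCoverable : m ≤ k → AllCoverableOver (Fin k) d m → AllCoverable d m
allCoverableOver-Fin⇒allCoverable m≤k cover = allCoverableOver-compress ℕ._≟_
  (allCoverableOver-embed (λ x → inject≤ x m≤k) (λ {x} {y} → inject≤-injective _ _ x y) cover)

hg-upper-bound : ∀ {n} → HIs d t → Wins (d + n) (BookAdj d n) k → k ≤ suc t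
hg-upper-bound (_ , maximal) W = ℕ.≮⇒≥ λ t<k →
  ℕ.<-irrefl refl (maximal _ (allCoverableOver-Fin⇒allCoverable (ℕ.<⇒≤ t<k)
                                (UpperBound.wins⇒allCoverableOver W t<k)))

module LowerBound {d t : ℕ} (cover : AllCoverable (suc d) t) (r : ℕ) where
  q = suc t
  Q = q ^ suc d
  n = Q ^ q + r
  open Book (suc d) n

  invertingGuess : Fin (Q ^ q) → Fin Q → Fin q
  invertingGuess g = preimage _≟_ (finToFun g) zero

  idleGuess : Fin r → Fin Q → Fin q
  idleGuess _ _ = zero

  pageGuess : Fin n → Fin Q → Fin q
  pageGuess = [ invertingGuess , idleGuess ]′ ∘ splitAt (Q ^ q)

  page-inverting : (g : Fin q → Fin Q) → Injective _≡_ _≡_ g →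
                   ∃ λ p → ∀ c → pageGuess p (g c) ≡ c
  page-inverting g g-inj = funToFin g ↑ˡ r , λ c → begin
    pageGuess (funToFin g ↑ˡ r) (g c)  ≡⟨ cong (λ s → [ invertingGuess , idleGuess ]′ s (g c))
                                               (splitAt-↑ˡ (Q ^ q) (funToFin g) r) ⟩
    preimage _≟_ ĝ zero (g c)          ≡⟨ cong (preimage _≟_ ĝ zero) (finToFun-funToFin g c) ⟨
    preimage _≟_ ĝ zero (ĝ c)          ≡⟨ preimage-injective _≟_ ĝ ĝ-injective c ⟩
    c                                  ∎
    where
    open ≡-Reasoning
    ĝ : Fin q → Fin Q
    ĝ = finToFun (funToFin g)
    ĝ-injective : Injective _≡_ _≡_ ĝ
    ĝ-injective {a} {b} e =
      g-inj (trans (sym (finToFun-funToFin g a)) (trans e (finToFun-funToFin g b)))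

  Losing : Vec (Fin q) n → Fin Q → Set
  Losing cs z = ∀ p → pageGuess p z ≢ lookup cs p

  losing? : ∀ cs z → Dec (Losing cs z)
  losing? cs z = all? λ p → ¬? (pageGuess p z ≟ lookup cs p)

  losing : Vec (Fin q) n → List (Fin Q)
  losing cs = filter (losing? cs) (allFin Q)

  losing-unique : ∀ cs → Unique (losing cs)
  losing-unique cs = filter⁺ (losing? cs) (allFin⁺ Q)

  losing-length : ∀ cs → length (losing cs) ≤ t
  losing-length cs = ℕ.≮⇒≥ λ t<length →
    let g = λ c → List.lookup (losing cs) (inject≤ c t<length)
        g-inj = λ {a} {b} → inject≤-injective t<length t<length a b ∘ lookup-injective (losing-unique cs)
        p , inverts = page-inverting g g-inj
        c = lookup cs p
        g[c]-losing = proj₂ (∈-filter⁻ (losing? cs) {xs = allFin Q} (∈-lookup _))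
    in g[c]-losing p (inverts c)

  losingPoint : ∀ cs → Fin (length (losing cs)) → Vec (Fin q) (suc d)
  losingPoint cs = decodeVec ∘ List.lookup (losing cs)

  -- Opaque so that type checking never unfolds the decision procedure producing the covering.
  opaque
    losingCover : ∀ cs → Σ _ (CoveredBy (losingPoint cs))
    losingCover cs =
      allCoverableOver-embed toℕ toℕ-injective (allCoverable-antitone (losing-length cs) cover)
        (losingPoint cs) (lookup-injective (losing-unique cs) ∘ decodeVec-injective)

  spineGuess : Vec (Fin q) n → Fin (suc d) → Vec (Fin q) (suc d) → Fin q
  spineGuess cs = recover _≟_ (losingPoint cs) (proj₁ (losingCover cs)) zero

  spineOf : Vec (Fin q) (suc d + n) → Vec (Fin q) (suc d)
  spineOf w = tabulate (lookup w ∘ spine)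

  pagesOf : Vec (Fin q) (suc d + n) → Vec (Fin q) n
  pagesOf w = tabulate (lookup w ∘ page)

  strategy : Strategy (suc d + n) (BookAdj (suc d) n) q
  strategy = viewStrategy bookAdj? zero λ v w →
    onVertices (λ i → spineGuess (pagesOf w) i (spineOf w))
               (λ p → pageGuess p (encodeVec (spineOf w))) v

  open Strategy strategy

  module _ (colouring : Fin (suc d + n) → Fin q) where

    seen : Fin (suc d + n) → Vec (Fin q) (suc d + n)
    seen v = view bookAdj? zero v colouring

    lookup-seen : ∀ {v u} → BookAdj (suc d) n v u → lookup (seen v) u ≡ colouring u
    lookup-seen = lookup-view bookAdj? zero colouring

    spineColours : Vec (Fin q) (suc d)
    spineColours = tabulate (colouring ∘ spine)

    pageColours : Vec (Fin q) n
    pageColours = tabulate (colouring ∘ page)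

    guess-page : ∀ p → guess (page p) colouring ≡ pageGuess p (encodeVec spineColours)
    guess-page p = trans (onVertices-page _ _ p)
      (cong (pageGuess p ∘ encodeVec) (tabulate-cong λ j → lookup-seen (page-adjacent p j)))

    guess-spine : ∀ i → guess (spine i) colouring ≡ spineGuess pageColours i (spineOf (seen (spine i)))
    guess-spine i = trans (onVertices-spine _ _ i)
      (cong (λ cs → spineGuess cs i (spineOf (seen (spine i))))
            (tabulate-cong λ p → lookup-seen (spine-adjacent i (page p) (spine≢page i p ∘ sym))))

    losing-spine-wins : Losing pageColours (encodeVec spineColours) →
                        ∃ λ i → guess (spine i) colouring ≡ colouring (spine i)
    losing-spine-wins lost = i , (begin
      guess (spine i) colouring                        ≡⟨ guess-spine i ⟩
      spineGuess pageColours i (spineOf (seen (spine i)))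
                                                       ≡⟨ recover-correct _≟_ _ σ cov a refl agree ⟩
      lookup (losingPoint pageColours a) i             ≡⟨ cong (λ u → lookup u i) point≡spineColours ⟩
      lookup spineColours i                            ≡⟨ lookup∘tabulate (colouring ∘ spine) i ⟩
      colouring (spine i)                              ∎)
      where
      open ≡-Reasoning
      member = ∈-filter⁺ (losing? pageColours) (∈-allFin (encodeVec spineColours)) lost
      a = Any.index member
      σ = proj₁ (losingCover pageColours)
      cov = proj₂ (losingCover pageColours)
      i = σ a

      point≡spineColours : losingPoint pageColours a ≡ spineColours
      point≡spineColours =
        trans (cong decodeVec (sym (lookup-index member))) (decodeVec-encodeVec spineColours)

      agree : AgreeOff i (losingPoint pageColours a) (spineOf (seen (spine i)))
      agree j j≢i = begin
        lookup (losingPoint pageColours a) j ≡⟨ cong (λ u → lookup u j) point≡spineColours ⟩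
        lookup spineColours j                ≡⟨ lookup∘tabulate (colouring ∘ spine) j ⟩
        colouring (spine j)                  ≡⟨ lookup-seen (spine-adjacent i _ (j≢i ∘ ↑ˡ-injective n j i)) ⟨
        lookup (seen (spine i)) (spine j)    ≡⟨ lookup∘tabulate (lookup (seen (spine i)) ∘ spine) j ⟨
        lookup (spineOf (seen (spine i))) j  ∎

    Winner : Fin (suc d + n) → Set
    Winner v = guess v colouring ≡ colouring v

    winner : ∃ Winner
    winner = byPages (any? λ p → guess (page p) colouring ≟ colouring (page p))
      where
      byPages : Dec (∃ (Winner ∘ page)) → ∃ Winner
      byPages (yes (p , right)) = page p , right
      byPages (no none) = spine (proj₁ spineWins) , proj₂ spineWins
        where
        spineWins = losing-spine-wins λ p right →
          none (p , trans (guess-page p) (trans right (lookup∘tabulate (colouring ∘ page) p)))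

  wins : Wins (suc d + n) (BookAdj (suc d) n) q
  wins = strategy , winner

hg-lower-bound : ∀ {n} → AllCoverable (suc d) t → (suc t ^ suc d) ^ suc t ≤ n →
                 Wins (suc d + n) (BookAdj (suc d) n) (suc t)
hg-lower-bound cover pages≤n with ℕ.m≤n⇒∃[o]m+o≡n pages≤n
... | r , refl = LowerBound.wins cover r

lemma5 : ∀ (d : ℕ) → 1 ≤ d →
    Σ ℕ λ n₀ → ∀ (n : ℕ) → n₀ ≤ n →
      Σ ℕ λ t → HIs d t × HGBookIs d n (suc t)
lemma5 (suc d) _ = (suc h ^ suc d) ^ suc h , λ n pages≤n →
  h , h-is , hg-lower-bound (proj₁ h-is) pages≤n , λ _ → hg-upper-bound h-is
  where
  h = proj₁ (h-exists d)
  h-is = proj₂ (h-exists d)
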